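{- Let $H$ be a $k$-uniform hypergraph. For every set $S \subseteq V(H)$ with $|S| \leq k-1$ and $\deg(S) \geq 1$ the following hold. (a) There are at least $\delta^+(H)$ vertices $x \in V(H)$ for which $\deg(S \cup \{x\}) \geq 1$. (b) For every set $U \subseteq V(H)$ with $|U| > |V(H)| - \delta^+(H)$ we have $\deg_{H[U]}(S) \geq 1$. (c) $\deg(S) \geq \binom{\delta^+(H)}{k-|S|}$.
   Context: For a set $S$ of vertices of a $k$-uniform hypergraph $H$, $\deg(S)=\deg_H(S)$ is the number of edges of $H$ containing $S$ as a subset; $H[U]$ denotes the subhypergraph induced on $U$. The minimum positive codegree $\delta^+(H)$ is the minimum of $\deg(S)$ over all sets $S$ of $k-1$ vertices of $H$ with $\deg(S)\geq 1$. -}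

module Defs where

open import Data.Nat using (ℕ; _≤_; _≡ᵇ_)
open import Data.Fin using (Fin)
open import Data.Fin.Subset using (Subset; _⊆_; ∣_∣)
open import Data.Fin.Subset.Properties using (_⊆?_)
open import Data.List using (List; length; filter; allFin)
open import Data.List.Relation.Unary.All using (All)
open import Data.List.Relation.Unary.Unique.Propositional using (Unique)
open import Data.Product using (_×_; Σ)
open import Relation.Binary.PropositionalEquality using (_≡_)
open import Relation.Nullary.Decidable using (_×-dec_)

record Hypergraph (n k : ℕ) : Set where
  field
    edges   : List (Subset n)
    unique  : Unique edges
    uniform : All (λ e → ∣ e ∣ ≡ k) edges
open Hypergraph public

deg : ∀ {n k} → Hypergraph n k → Subset n → ℕ
deg H S = length (filter (S ⊆?_) (edges H))

degInduced : ∀ {n k} → Hypergraph n k → Subset n → Subset n → ℕ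
degInduced H U S = length (filter (λ e → (S ⊆? e) ×-dec (e ⊆? U)) (edges H))

IsMinPosCodegree : ∀ {n k} → Hypergraph n k → ℕ → Set
IsMinPosCodegree {n} {k} H δ =
  Σ (Subset n) (λ S → ∣ S ∣ ≡ k Data.Nat.∸ 1 × 1 ≤ deg H S × deg H S ≡ δ)
  × (∀ (S : Subset n) → ∣ S ∣ ≡ k Data.Nat.∸ 1 → 1 ≤ deg H S → δ ≤ deg H S)

module Submission where

-- Call x a link vertex of T if x ∉ T and deg (T ∪ {x}) ≥ 1. The edges through a
-- (k−1)-set T are T ∪ {x} for distinct link vertices x, so T has at least
-- deg T ≥ δ of them; a smaller set T of positive degree lies in a (k−1)-set
-- T′ inside one of its edges and inherits the link vertices of T′, which is (a).
-- For (b), fewer than δ vertices lie outside U, so some link vertex of T lies in U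
-- and T can be grown inside U until it is an edge. For (c), double counting the
-- pairs (x, e) with x ∉ T and T ∪ {x} ⊆ e gives
--   (k − |T|) deg T = Σ_{x ∉ T} deg (T ∪ {x}) ≥ δ · C(δ, k − |T| − 1),
-- using the δ link vertices and induction on k − |T|; then (j + 1) C(δ, j + 1) ≤ δ C(δ, j).

open import Defs
open import Data.Fin using (Fin; zero; suc)
open import Data.Fin.Properties using (any?)
open import Data.Fin.Subset
open import Data.Fin.Subset.Properties
open import Data.List using (List; []; _∷_; length; filter; map; allFin; tabulate)
open import Data.List.Membership.Propositional using (find; lose) renaming (_∈_ to _∈ₗ_)
open import Data.List.Membership.Propositional.Properties using (∈-filter⁻)
open import Data.List.Properties using (filter-≐; filter-some; filter-none)
open import Data.List.Relation.Unary.All as All using (All; []; _∷_)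
open import Data.List.Relation.Unary.AllPairs using ([]; _∷_)
open import Data.List.Relation.Unary.Any using (Any; here; there)
open import Data.List.Relation.Unary.Unique.Propositional using (Unique)
open import Data.List.Relation.Unary.Unique.Propositional.Properties using (filter⁺)
open import Data.Nat using (ℕ; zero; suc; _+_; _*_; _∸_; _≤_; _<_; z≤n; s≤s; z<s; s≤s⁻¹)
open import Data.Nat.Combinatorics using (_C_; nC1≡n; nCk+nC[k+1]≡[n+1]C[k+1])
open import Data.Nat.ListAction using (sum)
open import Data.Nat.Properties
open import Algebra.Properties.CommutativeSemigroup +-commutativeSemigroup using (interchange)
open import Data.Nat.Tactic.RingSolver using (solve-∀)
open import Data.Product using (∃; _×_; _,_; proj₁; proj₂)
open import Data.Sum using (inj₂; [_,_])
open import Data.Vec using ([]; _∷_; here; there)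
open import Function using (_∘_)
open import Relation.Binary.Core using (REL)
open import Relation.Binary.Definitions using () renaming (Decidable to Decidable₂)
open import Relation.Binary.PropositionalEquality hiding ([_])
open import Relation.Nullary using (Dec; ¬_; ¬?; yes; no; contradiction)
open import Relation.Nullary.Decidable using (_×-dec_; decidable-stable)
open import Relation.Unary using (Pred; Decidable)

private
  variable
    n : ℕ

-- Counting along lists

module _ {a p} {A : Set a} {P : Pred A p} (P? : Decidable P) where

  length-filter-∷ : ∀ x xs → length (filter P? (x ∷ xs)) ≡ length (filter P? (x ∷ [])) + length (filter P? xs)
  length-filter-∷ x xs with P? x
  ... | yes _ = refl
  ... | no _ = refl

  filter-some⁻ : ∀ {xs} → 0 < length (filter P? xs) → Any P xs
  filter-some⁻ {x ∷ xs} pos with P? x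
  ... | yes px = here px
  ... | no _ = there (filter-some⁻ pos)

  length-filter*≤sum : ∀ {b} (f : A → ℕ) → (∀ {x} → P x → b ≤ f x) →
                       ∀ xs → length (filter P? xs) * b ≤ sum (map f xs)
  length-filter*≤sum f b≤f [] = z≤n
  length-filter*≤sum f b≤f (x ∷ xs) with P? x
  ... | yes px = +-mono-≤ (b≤f px) (length-filter*≤sum f b≤f xs)
  ... | no _ = ≤-trans (length-filter*≤sum f b≤f xs) (m≤n+m _ (f x))

  sum≤length-filter* : ∀ {c} (f : A → ℕ) → (∀ x → f x ≤ c) → (∀ {x} → 0 < f x → P x) →
                       ∀ xs → sum (map f xs) ≤ length (filter P? xs) * c
  sum≤length-filter* f f≤c f>0⇒P [] = z≤n
  sum≤length-filter* f f≤c f>0⇒P (x ∷ xs) with P? x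
  ... | yes _ = +-mono-≤ (f≤c x) (sum≤length-filter* f f≤c f>0⇒P xs)
  ... | no ¬px = +-mono-≤ (≮⇒≥ (¬px ∘ f>0⇒P)) (sum≤length-filter* f f≤c f>0⇒P xs)

  sum≡length-filter* : ∀ {c} (f : A → ℕ) {xs} →
                       All (λ x → (P x → f x ≡ c) × (¬ P x → f x ≡ 0)) xs →
                       sum (map f xs) ≡ length (filter P? xs) * c
  sum≡length-filter* f [] = refl
  sum≡length-filter* f {x ∷ _} ((on , off) ∷ rest) with P? x
  ... | yes px = cong₂ _+_ (on px) (sum≡length-filter* f rest)
  ... | no ¬px = cong₂ _+_ (off ¬px) (sum≡length-filter* f rest)

module _ {a p q} {A : Set a} {P : Pred A p} {Q : Pred A q} (P? : Decidable P) (Q? : Decidable Q) where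

  length-filter-mono : (∀ {x} → P x → Q x) → ∀ xs → length (filter P? xs) ≤ length (filter Q? xs)
  length-filter-mono P⇒Q [] = z≤n
  length-filter-mono P⇒Q (x ∷ xs) with P? x | Q? x
  ... | yes _  | yes _  = s≤s (length-filter-mono P⇒Q xs)
  ... | yes px | no ¬qx = contradiction (P⇒Q px) ¬qx
  ... | no _   | yes _  = m≤n⇒m≤1+n (length-filter-mono P⇒Q xs)
  ... | no _   | no _   = length-filter-mono P⇒Q xs

Unique∧All≡⇒length≤1 : ∀ {a} {A : Set a} {x : A} {xs} → Unique xs → All (_≡ x) xs → length xs ≤ 1
Unique∧All≡⇒length≤1 [] [] = z≤n
Unique∧All≡⇒length≤1 (_ ∷ _) (_ ∷ []) = s≤s z≤n
Unique∧All≡⇒length≤1 ((y≢z ∷ _) ∷ _) (y≡x ∷ z≡x ∷ _) = contradiction (trans y≡x (sym z≡x)) y≢z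

module _ {a b r} {A : Set a} {B : Set b} {R : REL A B r} (R? : Decidable₂ R) where

  sum-length-filter-comm : ∀ xs ys →
    sum (map (λ x → length (filter (R? x) ys)) xs) ≡
    sum (map (λ y → length (filter (λ x → R? x y) xs)) ys)
  sum-length-filter-comm [] ys = sym (sum-zeros ys)
    where
    sum-zeros : ∀ ys → sum (map (λ _ → 0) ys) ≡ 0
    sum-zeros [] = refl
    sum-zeros (_ ∷ ys) = sum-zeros ys
  sum-length-filter-comm (x ∷ xs) ys =
    trans (cong (length (filter (R? x) ys) +_) (sum-length-filter-comm xs ys)) (sym (peel ys))
    where
    column : B → List A → ℕ
    column y xs = length (filter (λ x′ → R? x′ y) xs)

    column-∷ : ∀ y → column y (x ∷ []) ≡ length (filter (R? x) (y ∷ []))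
    column-∷ y with R? x y
    ... | yes _ = refl
    ... | no _ = refl

    peel : ∀ ys → sum (map (λ y → column y (x ∷ xs)) ys) ≡
                  length (filter (R? x) ys) + sum (map (λ y → column y xs) ys)
    peel [] = refl
    peel (y ∷ ys) = begin
      column y (x ∷ xs) + sum (map (λ y → column y (x ∷ xs)) ys)
        ≡⟨ cong₂ _+_ (length-filter-∷ (λ x′ → R? x′ y) x xs) (peel ys) ⟩
      (column y (x ∷ []) + cy) + (row + rest)
        ≡⟨ interchange (column y (x ∷ [])) cy row rest ⟩
      (column y (x ∷ []) + row) + (cy + rest)
        ≡⟨ cong (λ i → (i + row) + (cy + rest)) (column-∷ y) ⟩
      (length (filter (R? x) (y ∷ [])) + row) + (cy + rest)
        ≡⟨ cong (_+ (cy + rest)) (length-filter-∷ (R? x) y ys) ⟨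
      length (filter (R? x) (y ∷ ys)) + (cy + rest) ∎
      where
      open ≡-Reasoning
      cy row rest : ℕ
      cy = column y xs
      row = length (filter (R? x) ys)
      rest = sum (map (λ y → column y xs) ys)

-- Finite subsets

x∈p─q⇒x∉q : ∀ {x : Fin n} {p q} → x ∈ p ─ q → x ∉ q
x∈p─q⇒x∉q {p = _ ∷ _} {outside ∷ _} here ()
x∈p─q⇒x∉q {p = _ ∷ _} {_ ∷ _} (there x∈p─q) (there x∈q) = x∈p─q⇒x∉q x∈p─q x∈q

p⊆q⇒∣q─p∣≡∣q∣∸∣p∣ : ∀ {p q : Subset n} → p ⊆ q → ∣ q ─ p ∣ ≡ ∣ q ∣ ∸ ∣ p ∣
p⊆q⇒∣q─p∣≡∣q∣∸∣p∣ {p = []} {[]} _ = refl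
p⊆q⇒∣q─p∣≡∣q∣∸∣p∣ {p = inside ∷ p} {inside ∷ q} p⊆q = p⊆q⇒∣q─p∣≡∣q∣∸∣p∣ (drop-∷-⊆ p⊆q)
p⊆q⇒∣q─p∣≡∣q∣∸∣p∣ {p = inside ∷ p} {outside ∷ q} p⊆q = contradiction (p⊆q here) λ ()
p⊆q⇒∣q─p∣≡∣q∣∸∣p∣ {p = outside ∷ p} {inside ∷ q} p⊆q =
  trans (cong suc (p⊆q⇒∣q─p∣≡∣q∣∸∣p∣ (drop-∷-⊆ p⊆q))) (sym (+-∸-assoc 1 (p⊆q⇒∣p∣≤∣q∣ (drop-∷-⊆ p⊆q))))
p⊆q⇒∣q─p∣≡∣q∣∸∣p∣ {p = outside ∷ p} {outside ∷ q} p⊆q = p⊆q⇒∣q─p∣≡∣q∣∸∣p∣ (drop-∷-⊆ p⊆q)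

x∉p⇒∣p∪⁅x⁆∣≡1+∣p∣ : ∀ {x : Fin n} {p} → x ∉ p → ∣ p ∪ ⁅ x ⁆ ∣ ≡ suc ∣ p ∣
x∉p⇒∣p∪⁅x⁆∣≡1+∣p∣ {x = zero} {inside ∷ p} x∉p = contradiction here x∉p
x∉p⇒∣p∪⁅x⁆∣≡1+∣p∣ {x = zero} {outside ∷ p} _ = cong (suc ∘ ∣_∣) (∪-identityʳ p)
x∉p⇒∣p∪⁅x⁆∣≡1+∣p∣ {x = suc x} {inside ∷ p} x∉p = cong suc (x∉p⇒∣p∪⁅x⁆∣≡1+∣p∣ (x∉p ∘ there))
x∉p⇒∣p∪⁅x⁆∣≡1+∣p∣ {x = suc x} {outside ∷ p} x∉p = x∉p⇒∣p∪⁅x⁆∣≡1+∣p∣ (x∉p ∘ there)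

p⊆q∧∣p∣<∣q∣⇒p⊂q : ∀ {p q : Subset n} → p ⊆ q → ∣ p ∣ < ∣ q ∣ → p ⊂ q
p⊆q∧∣p∣<∣q∣⇒p⊂q {p = p} {q} p⊆q ∣p∣<∣q∣ with any? (λ x → (x ∈? q) ×-dec ¬? (x ∈? p))
... | yes (x , x∈q , x∉p) = p⊆q , x , x∈q , x∉p
... | no ∄ = contradiction (p⊆q⇒∣p∣≤∣q∣ q⊆p) (<⇒≱ ∣p∣<∣q∣)
  where
  q⊆p : q ⊆ p
  q⊆p {x} x∈q = decidable-stable (x ∈? p) (λ x∉p → ∄ (x , x∈q , x∉p))

p⊆q∧∣q∣≤∣p∣⇒p≡q : ∀ {p q : Subset n} → p ⊆ q → ∣ q ∣ ≤ ∣ p ∣ → p ≡ q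
p⊆q∧∣q∣≤∣p∣⇒p≡q {p = p} {q} p⊆q ∣q∣≤∣p∣ = ⊆-antisym p⊆q q⊆p
  where
  q⊆p : q ⊆ p
  q⊆p {x} x∈q = decidable-stable (x ∈? p) (λ x∉p → <⇒≱ (p⊂q⇒∣p∣<∣q∣ (p⊆q , x , x∈q , x∉p)) ∣q∣≤∣p∣)

x∈p∪⁅x⁆ : ∀ (p : Subset n) x → x ∈ p ∪ ⁅ x ⁆
x∈p∪⁅x⁆ p x = x∈p∪q⁺ (inj₂ (x∈⁅x⁆ x))

p⊆r∧x∈r⇒p∪⁅x⁆⊆r : ∀ {p r : Subset n} {x} → p ⊆ r → x ∈ r → p ∪ ⁅ x ⁆ ⊆ r
p⊆r∧x∈r⇒p∪⁅x⁆⊆r {p = p} {r} {x} p⊆r x∈r y∈p∪⁅x⁆ =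
  [ p⊆r , (λ y∈⁅x⁆ → subst (_∈ r) (sym (x∈⁅y⁆⇒x≡y x y∈⁅x⁆)) x∈r) ] (x∈p∪q⁻ p ⁅ x ⁆ y∈p∪⁅x⁆)

length-filter-tabulate : ∀ {a p} {A : Set a} {P : Pred A p} (P? : Decidable P) {n} (f : Fin n → A) →
                         length (filter P? (tabulate f)) ≡ length (filter (P? ∘ f) (allFin n))
length-filter-tabulate P? {zero} f = refl
length-filter-tabulate P? {suc n} f with P? (f zero)
... | yes _ = cong suc (trans (length-filter-tabulate P? (f ∘ suc)) (sym (length-filter-tabulate (P? ∘ f) suc)))
... | no _ = trans (length-filter-tabulate P? (f ∘ suc)) (sym (length-filter-tabulate (P? ∘ f) suc))

length-filter-∈-allFin : ∀ (p : Subset n) → length (filter (_∈? p) (allFin n)) ≡ ∣ p ∣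
length-filter-∈-tabulate-suc : ∀ {s} (p : Subset n) → length (filter (_∈? s ∷ p) (tabulate suc)) ≡ ∣ p ∣

length-filter-∈-allFin [] = refl
length-filter-∈-allFin (inside ∷ p) = cong suc (length-filter-∈-tabulate-suc p)
length-filter-∈-allFin (outside ∷ p) = length-filter-∈-tabulate-suc p

length-filter-∈-tabulate-suc {s = s} p = begin
  length (filter (_∈? s ∷ p) (tabulate suc))        ≡⟨ length-filter-tabulate (_∈? s ∷ p) suc ⟩
  length (filter ((_∈? s ∷ p) ∘ suc) (allFin _))    ≡⟨ cong length (filter-≐ _ (_∈? p) (drop-there , there) (allFin _)) ⟩
  length (filter (_∈? p) (allFin _))                ≡⟨ length-filter-∈-allFin p ⟩
  ∣ p ∣                                             ∎
  where open ≡-Reasoning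

length-filter-∉-allFin : ∀ (p : Subset n) → length (filter (¬? ∘ (_∈? p)) (allFin n)) ≡ n ∸ ∣ p ∣
length-filter-∉-allFin {n} p = begin
  length (filter (¬? ∘ (_∈? p)) (allFin n))  ≡⟨ cong length (filter-≐ _ (_∈? ∁ p) (x∉p⇒x∈∁p , x∈∁p⇒x∉p) (allFin n)) ⟩
  length (filter (_∈? ∁ p) (allFin n))       ≡⟨ length-filter-∈-allFin (∁ p) ⟩
  ∣ ∁ p ∣                                    ≡⟨ ∣∁p∣≡n∸∣p∣ p ⟩
  n ∸ ∣ p ∣                                  ∎
  where open ≡-Reasoning

grow-to-size : ∀ {p} (P : Subset n → Set p) {m} →
               (∀ {T} → P T → ∣ T ∣ < m → ∃ λ x → x ∉ T × P (T ∪ ⁅ x ⁆)) →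
               ∀ {T} → P T → ∣ T ∣ ≤ m → ∃ λ T′ → T ⊆ T′ × P T′ × ∣ T′ ∣ ≡ m
grow-to-size P {m} step {T} PT ∣T∣≤m = go (m ∸ ∣ T ∣) PT (m+[n∸m]≡n ∣T∣≤m)
  where
  go : ∀ d {T} → P T → ∣ T ∣ + d ≡ m → ∃ λ T′ → T ⊆ T′ × P T′ × ∣ T′ ∣ ≡ m
  go zero {T} PT eq = T , ⊆-refl , PT , trans (sym (+-identityʳ ∣ T ∣)) eq
  go (suc d) {T} PT eq with step PT (subst (∣ T ∣ <_) eq (m<m+n ∣ T ∣ z<s))
  ... | x , x∉T , PT∪x with go d PT∪x (trans (cong (_+ d) (x∉p⇒∣p∪⁅x⁆∣≡1+∣p∣ x∉T)) (trans (sym (+-suc ∣ T ∣ d)) eq))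
  ... | T′ , T∪x⊆T′ , PT′ , ∣T′∣≡m = T′ , T∪x⊆T′ ∘ p⊆p∪q ⁅ x ⁆ , PT′ , ∣T′∣≡m

-- Binomial coefficients

[k+1]*nC[k+1]≤n*nCk : ∀ n k → suc k * (n C suc k) ≤ n * (n C k)
[k+1]*nC[k+1]≤n*nCk zero k = ≤-reflexive (*-zeroʳ (suc k))
[k+1]*nC[k+1]≤n*nCk (suc n) zero = ≤-reflexive (begin-equality
  1 * (suc n C 1)  ≡⟨ *-identityˡ _ ⟩
  suc n C 1        ≡⟨ nC1≡n (suc n) ⟩
  suc n            ≡⟨ *-identityʳ (suc n) ⟨
  suc n * 1        ∎)
  where open ≤-Reasoning
[k+1]*nC[k+1]≤n*nCk (suc n) (suc k) = begin
  (2 + k) * (suc n C (2 + k))      ≡⟨ cong ((2 + k) *_) (nCk+nC[k+1]≡[n+1]C[k+1] n (suc k)) ⟨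
  (2 + k) * (b + c)                ≡⟨ *-distribˡ-+ (2 + k) b c ⟩
  (2 + k) * b + (2 + k) * c        ≤⟨ +-monoʳ-≤ ((2 + k) * b) ([k+1]*nC[k+1]≤n*nCk n (suc k)) ⟩
  (2 + k) * b + n * b              ≡⟨ shift k n b ⟩
  (1 + k) * b + (1 + n) * b        ≤⟨ +-monoˡ-≤ ((1 + n) * b) ([k+1]*nC[k+1]≤n*nCk n k) ⟩
  n * a + (1 + n) * b              ≤⟨ +-monoˡ-≤ ((1 + n) * b) (*-monoˡ-≤ a (n≤1+n n)) ⟩
  (1 + n) * a + (1 + n) * b        ≡⟨ *-distribˡ-+ (1 + n) a b ⟨
  (1 + n) * (a + b)                ≡⟨ cong ((1 + n) *_) (nCk+nC[k+1]≡[n+1]C[k+1] n k) ⟩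
  suc n * (suc n C suc k)          ∎
  where
  open ≤-Reasoning
  a b c : ℕ
  a = n C k
  b = n C suc k
  c = n C (2 + k)
  shift : ∀ k n b → (2 + k) * b + n * b ≡ (1 + k) * b + (1 + n) * b
  shift = solve-∀

-- Degrees in a uniform hypergraph

module _ {k} (H : Hypergraph n k) where

  ∣edge∣≡k : ∀ {e} → e ∈ₗ edges H → ∣ e ∣ ≡ k
  ∣edge∣≡k = All.lookup (uniform H)

  edge⇒1≤deg : ∀ {T e} → e ∈ₗ edges H → T ⊆ e → 1 ≤ deg H T
  edge⇒1≤deg {T} e∈E T⊆e = filter-some (T ⊆?_) (lose e∈E T⊆e)

  1≤deg⇒edge : ∀ {T} → 1 ≤ deg H T → ∃ λ e → e ∈ₗ edges H × T ⊆ e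
  1≤deg⇒edge {T} pos = find (filter-some⁻ (T ⊆?_) pos)

  deg-antitone : ∀ {T T′} → T ⊆ T′ → deg H T′ ≤ deg H T
  deg-antitone T⊆T′ = length-filter-mono (_ ⊆?_) (_ ⊆?_) (⊆-trans T⊆T′) (edges H)

  ∣T∣≡k⇒deg≤1 : ∀ {T} → ∣ T ∣ ≡ k → deg H T ≤ 1
  ∣T∣≡k⇒deg≤1 {T} ∣T∣≡k = Unique∧All≡⇒length≤1 (filter⁺ (T ⊆?_) (unique H)) (All.tabulate edge≡T)
    where
    edge≡T : ∀ {e} → e ∈ₗ filter (T ⊆?_) (edges H) → e ≡ T
    edge≡T e∈ with ∈-filter⁻ (T ⊆?_) e∈
    ... | e∈E , T⊆e = sym (p⊆q∧∣q∣≤∣p∣⇒p≡q T⊆e (≤-reflexive (trans (∣edge∣≡k e∈E) (sym ∣T∣≡k))))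

  1≤deg-extend : ∀ {T} → 1 ≤ deg H T → ∣ T ∣ < k → ∃ λ x → x ∉ T × 1 ≤ deg H (T ∪ ⁅ x ⁆)
  1≤deg-extend pos ∣T∣<k with 1≤deg⇒edge pos
  ... | e , e∈E , T⊆e with p⊆q∧∣p∣<∣q∣⇒p⊂q T⊆e (subst (_ <_) (sym (∣edge∣≡k e∈E)) ∣T∣<k)
  ... | _ , x , x∈e , x∉T = x , x∉T , edge⇒1≤deg e∈E (p⊆r∧x∈r⇒p∪⁅x⁆⊆r T⊆e x∈e)

  Link : Subset n → Fin n → Set
  Link T x = x ∉ T × 1 ≤ deg H (T ∪ ⁅ x ⁆)

  link? : ∀ T → Decidable (Link T)
  link? T x = ¬? (x ∈? T) ×-dec (1 ≤? deg H (T ∪ ⁅ x ⁆))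

  ∣link∣ : Subset n → ℕ
  ∣link∣ T = length (filter (link? T) (allFin n))

  link-antitone : ∀ {T T′ x} → T ⊆ T′ → Link T′ x → Link T x
  link-antitone {x = x} T⊆T′ (x∉T′ , pos) =
    x∉T′ ∘ T⊆T′ , ≤-trans pos (deg-antitone (p⊆r∧x∈r⇒p∪⁅x⁆⊆r (⊆-trans T⊆T′ (p⊆p∪q ⁅ x ⁆)) (x∈p∪⁅x⁆ _ x)))

  Extends : Subset n → Fin n → Subset n → Set
  Extends T x e = x ∉ T × T ∪ ⁅ x ⁆ ⊆ e

  extends? : ∀ T → Decidable₂ (Extends T)
  extends? T x e = ¬? (x ∈? T) ×-dec (T ∪ ⁅ x ⁆ ⊆? e)

  extDeg : Subset n → Fin n → ℕ
  extDeg T x = length (filter (extends? T x) (edges H))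

  x∉T⇒extDeg≡deg : ∀ {T x} → x ∉ T → extDeg T x ≡ deg H (T ∪ ⁅ x ⁆)
  x∉T⇒extDeg≡deg {T} {x} x∉T = cong length (filter-≐ (extends? T x) (T ∪ ⁅ x ⁆ ⊆?_) (proj₂ , (x∉T ,_)) (edges H))

  0<extDeg⇒link : ∀ {T x} → 0 < extDeg T x → Link T x
  0<extDeg⇒link {T} {x} pos with find (filter-some⁻ (extends? T x) pos)
  ... | e , e∈E , x∉T , T∪x⊆e = x∉T , edge⇒1≤deg e∈E T∪x⊆e

  sum-extDeg : ∀ T → sum (map (extDeg T) (allFin n)) ≡ deg H T * (k ∸ ∣ T ∣)
  sum-extDeg T = begin
    sum (map (extDeg T) (allFin n))
      ≡⟨ sum-length-filter-comm (extends? T) (allFin n) (edges H) ⟩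
    sum (map (λ e → length (filter (λ x → extends? T x e) (allFin n))) (edges H))
      ≡⟨ sum≡length-filter* (T ⊆?_) _ (All.map (λ ∣e∣≡k → ⊆-case ∣e∣≡k , ⊈-case) (uniform H)) ⟩
    deg H T * (k ∸ ∣ T ∣) ∎
    where
    open ≡-Reasoning
    ⊆-case : ∀ {e} → ∣ e ∣ ≡ k → T ⊆ e → length (filter (λ x → extends? T x e) (allFin n)) ≡ k ∸ ∣ T ∣
    ⊆-case {e} ∣e∣≡k T⊆e = begin
      length (filter (λ x → extends? T x e) (allFin n))
        ≡⟨ cong length (filter-≐ _ (_∈? e ─ T) (into , out-of) (allFin n)) ⟩
      length (filter (_∈? e ─ T) (allFin n))  ≡⟨ length-filter-∈-allFin (e ─ T) ⟩
      ∣ e ─ T ∣                              ≡⟨ p⊆q⇒∣q─p∣≡∣q∣∸∣p∣ T⊆e ⟩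
      ∣ e ∣ ∸ ∣ T ∣                          ≡⟨ cong (_∸ ∣ T ∣) ∣e∣≡k ⟩
      k ∸ ∣ T ∣                              ∎
      where
      into : ∀ {x} → Extends T x e → x ∈ e ─ T
      into {x} (x∉T , T∪x⊆e) = x∈p∧x∉q⇒x∈p─q (T∪x⊆e (x∈p∪⁅x⁆ _ x)) x∉T
      out-of : ∀ {x} → x ∈ e ─ T → Extends T x e
      out-of x∈e─T = x∈p─q⇒x∉q x∈e─T , p⊆r∧x∈r⇒p∪⁅x⁆⊆r T⊆e (p─q⊆p e T x∈e─T)
    ⊈-case : ∀ {e} → ¬ T ⊆ e → length (filter (λ x → extends? T x e) (allFin n)) ≡ 0
    ⊈-case {e} T⊈e = cong length (filter-none (λ x → extends? T x e)
      (All.universal (λ x (_ , T∪x⊆e) → T⊈e (⊆-trans (p⊆p∪q ⁅ x ⁆) T∪x⊆e)) (allFin n)))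

-- Edges have size suc k, so the paper's (k − 1)-sets are the k-sets here; δ only
-- needs to bound their positive codegrees from below.
module Codegree {k} (H : Hypergraph n (suc k)) {δ}
                (δ≤deg : ∀ S → ∣ S ∣ ≡ k → 1 ≤ deg H S → δ ≤ deg H S) where

  deg≤∣link∣ : ∀ {T} → ∣ T ∣ ≡ k → deg H T ≤ ∣link∣ H T
  deg≤∣link∣ {T} ∣T∣≡k = begin
    deg H T                               ≡⟨ *-identityʳ (deg H T) ⟨
    deg H T * 1                           ≡⟨ cong (deg H T *_) (subst (λ i → suc i ∸ ∣ T ∣ ≡ 1) ∣T∣≡k (m+n∸n≡m 1 ∣ T ∣)) ⟨
    deg H T * (suc k ∸ ∣ T ∣)             ≡⟨ sum-extDeg H T ⟨
    sum (map (extDeg H T) (allFin n))     ≤⟨ sum≤length-filter* (link? H T) (extDeg H T) extDeg≤1 (0<extDeg⇒link H) (allFin n) ⟩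
    ∣link∣ H T * 1                        ≡⟨ *-identityʳ (∣link∣ H T) ⟩
    ∣link∣ H T                            ∎
    where
    open ≤-Reasoning
    extDeg≤1 : ∀ x → extDeg H T x ≤ 1
    extDeg≤1 x = by-membership (x ∈? T)
      where
      by-membership : Dec (x ∈ T) → extDeg H T x ≤ 1
      by-membership (yes x∈T) = ≤-trans (≮⇒≥ (λ pos → proj₁ (0<extDeg⇒link H pos) x∈T)) z≤n
      by-membership (no x∉T) = begin
        extDeg H T x          ≡⟨ x∉T⇒extDeg≡deg H x∉T ⟩
        deg H (T ∪ ⁅ x ⁆)     ≤⟨ ∣T∣≡k⇒deg≤1 H (trans (x∉p⇒∣p∪⁅x⁆∣≡1+∣p∣ x∉T) (cong suc ∣T∣≡k)) ⟩
        1                     ∎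

  δ≤∣link∣ : ∀ {T} → ∣ T ∣ ≤ k → 1 ≤ deg H T → δ ≤ ∣link∣ H T
  δ≤∣link∣ {T} ∣T∣≤k pos with grow-to-size (λ X → 1 ≤ deg H X) (λ pos< lt → 1≤deg-extend H pos< (m<n⇒m<1+n lt)) pos ∣T∣≤k
  ... | T′ , T⊆T′ , pos′ , ∣T′∣≡k = begin
    δ             ≤⟨ δ≤deg T′ ∣T′∣≡k pos′ ⟩
    deg H T′      ≤⟨ deg≤∣link∣ ∣T′∣≡k ⟩
    ∣link∣ H T′   ≤⟨ length-filter-mono (link? H T′) (link? H T) (link-antitone H T⊆T′) (allFin n) ⟩
    ∣link∣ H T    ∎
    where open ≤-Reasoning

  1≤deg⇒link-inside : ∀ {T U} → T ⊆ U → n ∸ δ < ∣ U ∣ → ∣ T ∣ ≤ k → 1 ≤ deg H T →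
                      ∃ λ x → x ∉ T × (T ∪ ⁅ x ⁆ ⊆ U × 1 ≤ deg H (T ∪ ⁅ x ⁆))
  1≤deg⇒link-inside {T} {U} T⊆U n∸δ<∣U∣ ∣T∣≤k pos with any? (λ x → link? H T x ×-dec (x ∈? U))
  ... | yes (x , (x∉T , pos′) , x∈U) = x , x∉T , p⊆r∧x∈r⇒p∪⁅x⁆⊆r T⊆U x∈U , pos′
  ... | no ∄ = contradiction ∣U∣≤n∸δ (<⇒≱ n∸δ<∣U∣)
    where
    open ≤-Reasoning
    δ≤n∸∣U∣ : δ ≤ n ∸ ∣ U ∣
    δ≤n∸∣U∣ = begin
      δ                                         ≤⟨ δ≤∣link∣ ∣T∣≤k pos ⟩
      ∣link∣ H T                                ≤⟨ length-filter-mono (link? H T) (¬? ∘ (_∈? U)) (λ {x} lnk x∈U → ∄ (x , lnk , x∈U)) (allFin n) ⟩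
      length (filter (¬? ∘ (_∈? U)) (allFin n)) ≡⟨ length-filter-∉-allFin U ⟩
      n ∸ ∣ U ∣                                 ∎
    ∣U∣≤n∸δ : ∣ U ∣ ≤ n ∸ δ
    ∣U∣≤n∸δ = begin
      ∣ U ∣               ≡⟨ m∸[m∸n]≡n (∣p∣≤n U) ⟨
      n ∸ (n ∸ ∣ U ∣)     ≤⟨ ∸-monoʳ-≤ n δ≤n∸∣U∣ ⟩
      n ∸ δ               ∎

  1≤degInduced : ∀ {S U} → S ⊆ U → n ∸ δ < ∣ U ∣ → ∣ S ∣ ≤ k → 1 ≤ deg H S → 1 ≤ degInduced H U S
  1≤degInduced {S} {U} S⊆U n∸δ<∣U∣ ∣S∣≤k pos
    with grow-to-size (λ X → X ⊆ U × 1 ≤ deg H X) step (S⊆U , pos) (m≤n⇒m≤1+n ∣S∣≤k)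
    where
    step : ∀ {X} → X ⊆ U × 1 ≤ deg H X → ∣ X ∣ < suc k → ∃ λ x → x ∉ X × (X ∪ ⁅ x ⁆ ⊆ U × 1 ≤ deg H (X ∪ ⁅ x ⁆))
    step (X⊆U , posX) ∣X∣<1+k = 1≤deg⇒link-inside X⊆U n∸δ<∣U∣ (s≤s⁻¹ ∣X∣<1+k) posX
  ... | T , S⊆T , (T⊆U , posT) , ∣T∣≡1+k with 1≤deg⇒edge H posT
  ... | e , e∈E , T⊆e with p⊆q∧∣q∣≤∣p∣⇒p≡q T⊆e (≤-reflexive (trans (∣edge∣≡k H e∈E) (sym ∣T∣≡1+k)))
  ... | refl = filter-some (λ e → (S ⊆? e) ×-dec (e ⊆? U)) (lose e∈E (S⊆T , T⊆U))

  C≤deg : ∀ j {T} → ∣ T ∣ + j ≡ k → 1 ≤ deg H T → δ C suc j ≤ deg H T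
  C≤deg zero {T} ∣T∣≡k pos = subst (_≤ deg H T) (sym (nC1≡n δ)) (δ≤deg T (trans (sym (+-identityʳ ∣ T ∣)) ∣T∣≡k) pos)
  C≤deg (suc j) {T} ∣T∣+1+j≡k pos = *-cancelˡ-≤ (2 + j) (begin
    (2 + j) * (δ C (2 + j))                ≤⟨ [k+1]*nC[k+1]≤n*nCk δ (suc j) ⟩
    δ * (δ C suc j)                        ≤⟨ *-monoˡ-≤ (δ C suc j) (δ≤∣link∣ (subst (∣ T ∣ ≤_) ∣T∣+1+j≡k (m≤m+n ∣ T ∣ (suc j))) pos) ⟩
    ∣link∣ H T * (δ C suc j)               ≤⟨ length-filter*≤sum (link? H T) (extDeg H T) C≤extDeg (allFin n) ⟩
    sum (map (extDeg H T) (allFin n))      ≡⟨ sum-extDeg H T ⟩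
    deg H T * (suc k ∸ ∣ T ∣)              ≡⟨ cong (deg H T *_) 1+k∸∣T∣≡2+j ⟩
    deg H T * (2 + j)                      ≡⟨ *-comm (deg H T) (2 + j) ⟩
    (2 + j) * deg H T                      ∎)
    where
    open ≤-Reasoning
    C≤extDeg : ∀ {x} → Link H T x → δ C suc j ≤ extDeg H T x
    C≤extDeg (x∉T , posx) = subst (_ ≤_) (sym (x∉T⇒extDeg≡deg H x∉T))
      (C≤deg j (trans (cong (_+ j) (x∉p⇒∣p∪⁅x⁆∣≡1+∣p∣ x∉T)) (trans (sym (+-suc ∣ T ∣ j)) ∣T∣+1+j≡k)) posx)
    1+k∸∣T∣≡2+j : suc k ∸ ∣ T ∣ ≡ 2 + j
    1+k∸∣T∣≡2+j = trans (cong (λ i → suc i ∸ ∣ T ∣) (sym ∣T∣+1+j≡k))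
                        (trans (cong (_∸ ∣ T ∣) (sym (+-suc ∣ T ∣ (suc j)))) (m+n∸m≡n ∣ T ∣ (2 + j)))

proposition1p2 : ∀ {n k : ℕ} (H : Hypergraph n k) (δ : ℕ) → 1 ≤ k
    → IsMinPosCodegree H δ
    → ∀ (S : Subset n) → ∣ S ∣ ≤ k ∸ 1 → 1 ≤ deg H S
    → (δ ≤ length (filter (λ x → 1 ≤? deg H (S ∪ ⁅ x ⁆)) (allFin n)))
    × (∀ (U : Subset n) → S ⊆ U → n ∸ δ < ∣ U ∣ → 1 ≤ degInduced H U S)
    × ((δ C (k ∸ ∣ S ∣)) ≤ deg H S)
proposition1p2 {n} {suc k} H δ (s≤s z≤n) (_ , δ≤deg) S ∣S∣≤k pos =
  ≤-trans (δ≤∣link∣ ∣S∣≤k pos) (length-filter-mono (link? H S) (λ x → 1 ≤? deg H (S ∪ ⁅ x ⁆)) proj₂ (allFin n)) ,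
  (λ U S⊆U n∸δ<∣U∣ → 1≤degInduced S⊆U n∸δ<∣U∣ ∣S∣≤k pos) ,
  subst (λ i → δ C i ≤ deg H S) (sym (+-∸-assoc 1 ∣S∣≤k)) (C≤deg (k ∸ ∣ S ∣) (m+[n∸m]≡n ∣S∣≤k) pos)
  where open Codegree H δ≤deg
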